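{- For all integers $k \ge s \ge 2$, the graph $\mathrm{Myc}_{k,s}$ is locally $s$-colourable, has chromatic number $k$, and has chromatic discrepancy $\varphi(\mathrm{Myc}_{k,s}) \le k-s+1$.
   Context: $\mathrm{Myc}_{s,s}=K_s$, and for $k>s$, $\mathrm{Myc}_{k,s}$ is the Mycielskian of $\mathrm{Myc}_{k-1,s}$: add, for each vertex $u$, a twin $u'$ adjacent to all neighbours of $u$, then a new vertex adjacent to all twins. A graph is locally $s$-colourable if for every vertex $v$ the subgraph induced by $N[v]$ has chromatic number at most $s$. For a proper colouring $\sigma$ of $G$, $\varphi_\sigma(G)=\max_{H}\big(|\sigma(V(H))|-\chi(H)\big)$ over all induced subgraphs $H$ of $G$, and $\varphi(G)=\min_\sigma\varphi_\sigma(G)$ over all proper colourings. -}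

module Defs where

open import Data.Nat using (ℕ; zero; suc; _+_; _≤_)
open import Data.Bool using (Bool; true; false; not; _∧_; _∨_; T)
open import Data.Fin using (Fin; zero; suc; splitAt; _≟_)
open import Data.Fin.Subset using (Subset; _∈_; ⊤; ∣_∣)
open import Data.Sum using (inj₁; inj₂)
open import Data.Product using (Σ; _×_)
open import Data.Vec using (tabulate; lookup)
open import Relation.Nullary using (¬_)
open import Relation.Nullary.Decidable using (⌊_⌋)
open import Relation.Binary.PropositionalEquality using (_≡_)

-- A finite graph on vertex set Fin n, given by a Boolean adjacency function.
-- (All graphs constructed below are simple: symmetric and loopless.)
record Graph : Set where
  field
    n   : ℕ
    adj : Fin n → Fin n → Bool
open Graph public

K : ℕ → Graph
K s = record { n = s ; adj = λ u v → not ⌊ u ≟ v ⌋ }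

-- Mycielskian. Vertex set Fin (suc (n + n)):
--   zero            = the new vertex w,
--   suc i, i = inj₁ u under splitAt n : original vertex u,
--   suc i, i = inj₂ u under splitAt n : twin u'.
module _ (G : Graph) where
  private
    m = n G
    a = adj G

  mycAdj : Fin (suc (m + m)) → Fin (suc (m + m)) → Bool
  mycAdj zero zero = false
  mycAdj zero (suc j) with splitAt m j
  ... | inj₁ _ = false
  ... | inj₂ _ = true
  mycAdj (suc i) zero with splitAt m i
  ... | inj₁ _ = false
  ... | inj₂ _ = true
  mycAdj (suc i) (suc j) with splitAt m i | splitAt m j
  ... | inj₁ u | inj₁ v = a u v
  ... | inj₁ u | inj₂ v = a u v
  ... | inj₂ u | inj₁ v = a u v
  ... | inj₂ _ | inj₂ _ = false

Mycielskian : Graph → Graph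
Mycielskian G = record { n = suc (n G + n G) ; adj = mycAdj G }

-- MycIter s j = Myc_{s+j,s}
MycIter : ℕ → ℕ → Graph
MycIter s zero = K s
MycIter s (suc j) = Mycielskian (MycIter s j)

open import Data.Nat using (_∸_)
Myc : ℕ → ℕ → Graph
Myc k s = MycIter s (k ∸ s)

ProperOn : (G : Graph) → Subset (n G) → {m : ℕ} → (Fin (n G) → Fin m) → Set
ProperOn G S c = ∀ u v → u ∈ S → v ∈ S → T (adj G u v) → ¬ (c u ≡ c v)

ColourableOn : (G : Graph) → Subset (n G) → ℕ → Set
ColourableOn G S m = Σ (Fin (n G) → Fin m) (ProperOn G S)

IsChromaticNumberOn : (G : Graph) → Subset (n G) → ℕ → Set
IsChromaticNumberOn G S k = ColourableOn G S k × (∀ m → ColourableOn G S m → k ≤ m)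

IsChromaticNumber : Graph → ℕ → Set
IsChromaticNumber G k = IsChromaticNumberOn G ⊤ k

Proper : (G : Graph) → {m : ℕ} → (Fin (n G) → Fin m) → Set
Proper G c = ProperOn G ⊤ c

closedNbhd : (G : Graph) → Fin (n G) → Subset (n G)
closedNbhd G v = tabulate (λ u → ⌊ u ≟ v ⌋ ∨ adj G v u)

LocallyColourable : Graph → ℕ → Set
LocallyColourable G s = ∀ v → ColourableOn G (closedNbhd G v) s

anyFin : (n : ℕ) → (Fin n → Bool) → Bool
anyFin zero f = false
anyFin (suc n) f = f zero ∨ anyFin n (λ i → f (suc i))

image : (G : Graph) → {m : ℕ} → (Fin (n G) → Fin m) → Subset (n G) → Subset m
image G σ S = tabulate (λ c → anyFin (n G) (λ v → lookup S v ∧ ⌊ σ v ≟ c ⌋))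

-- φ_σ(G) ≤ d : for every induced subgraph H = G[S], |σ(V(H))| − χ(H) ≤ d.
DiscrepancyOfAtMost : (G : Graph) → {m : ℕ} → (Fin (n G) → Fin m) → ℕ → Set
DiscrepancyOfAtMost G σ d = ∀ S k → IsChromaticNumberOn G S k → ∣ image G σ S ∣ ≤ k + d

ChromaticDiscrepancyAtMost : Graph → ℕ → Set
ChromaticDiscrepancyAtMost G d =
  Σ ℕ (λ m → Σ (Fin (n G) → Fin m) (λ σ → Proper G σ × DiscrepancyOfAtMost G σ d))

{-# OPTIONS --safe #-}
-- A Mycielski step raises the chromatic number by exactly one, and it preserves local
-- s-colourability because closed neighbourhoods in the Mycielskian project onto closed
-- neighbourhoods of G.  For the discrepancy, colour the base clique K_s with s colours of its own
-- and, at each step, shift the other colours of the original vertices up by one, give all twins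
-- the fresh colour 0 and the hub the colour 1.  The base colours then sit on a clique only, so an
-- induced subgraph H sees at most χ(H) of them, besides at most k − s + 1 others.
module Submission where

open import Defs
open import Data.Nat using (ℕ; _≤_; _+_; _∸_)
open import Data.Product using (_×_)

open import Data.Nat using (zero; suc; z≤n; s≤s)
open import Data.Nat.Properties using (+-comm; m∸n+n≡m)
open import Data.Bool using (Bool; true; false; T)
open import Data.Bool.Properties using (T-≡; T-∨; T-∧)
open import Data.Empty using (⊥-elim)
import Data.Fin as Fin
open import Data.Fin using (Fin; zero; suc; splitAt; join; _↑ˡ_; _↑ʳ_; _≟_; fromℕ; inject₁; punchIn; punchOut)
open import Data.Fin.Properties
  using (suc-injective; ↑ˡ-injective; ↑ʳ-injective; splitAt-↑ˡ; splitAt-↑ʳ; splitAt⁻¹-↑ˡ; splitAt⁻¹-↑ʳ;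
         splitAt-join; fromℕ≢inject₁; inject₁-injective; punchInᵢ≢i; punchOut-injective; injective⇒≤; 0≢1+n)
open import Data.Fin.Subset using (Subset; _∈_; _∉_; ⊤; ∣_∣; inside; outside)
open import Data.Fin.Subset.Properties using (∈⊤)
open import Data.Sum using (_⊎_; inj₁; inj₂; map₁; map₂)
open import Data.Sum.Properties using (inj₁-injective; inj₂-injective)
open import Data.Product using (∃; _,_; proj₁)
import Data.Product as Product
open import Data.Vec using (tabulate; _∷_; []; here; there)
open import Data.Vec.Properties using (lookup∘tabulate; []=⇒lookup; lookup⇒[]=)
open import Function using (_∘_; id; Equivalence)
open import Relation.Nullary using (yes; no)
open import Relation.Nullary.Decidable
  using (⌊_⌋; toWitness; fromWitness; toWitnessFalse; fromWitnessFalse; decidable-stable)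
open import Relation.Binary.PropositionalEquality using (_≡_; _≢_; refl; sym; trans; cong; subst)

open Equivalence using (to; from)

∈tabulate⁻ : ∀ {n} {f : Fin n → Bool} {x} → x ∈ tabulate f → T (f x)
∈tabulate⁻ {f = f} {x} x∈ = from T-≡ (trans (sym (lookup∘tabulate f x)) ([]=⇒lookup x∈))

∈tabulate⁺ : ∀ {n} {f : Fin n → Bool} {x} → T (f x) → x ∈ tabulate f
∈tabulate⁺ {f = f} {x} t = lookup⇒[]= x _ (trans (lookup∘tabulate f x) (to T-≡ t))

anyFin⁻ : ∀ n (f : Fin n → Bool) → T (anyFin n f) → ∃ λ i → T (f i)
anyFin⁻ (suc n) f t with to T-∨ t
... | inj₁ t₀ = zero , t₀
... | inj₂ t₁ = Product.map suc id (anyFin⁻ n (f ∘ suc) t₁)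

injectiveOn⇒∣p∣≤ : ∀ {N k} (p : Subset N) (g : ∀ {x} → x ∈ p → Fin k) →
                   (∀ {x y} (x∈p : x ∈ p) (y∈p : y ∈ p) → g x∈p ≡ g y∈p → x ≡ y) → ∣ p ∣ ≤ k
injectiveOn⇒∣p∣≤ []            g g-inj = z≤n
injectiveOn⇒∣p∣≤ (outside ∷ p) g g-inj =
  injectiveOn⇒∣p∣≤ p (g ∘ there) (λ x∈p y∈p → suc-injective ∘ g-inj (there x∈p) (there y∈p))
injectiveOn⇒∣p∣≤ {k = zero}  (inside ∷ p) g g-inj with g here
... | ()
injectiveOn⇒∣p∣≤ {k = suc k} (inside ∷ p) g g-inj = s≤s (injectiveOn⇒∣p∣≤ p h h-inj)
  where
  g₀≢ : ∀ {x} (x∈p : x ∈ p) → g here ≢ g (there x∈p)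
  g₀≢ x∈p = 0≢1+n ∘ g-inj here (there x∈p)
  h : ∀ {x} → x ∈ p → Fin k
  h x∈p = punchOut (g₀≢ x∈p)
  h-inj : ∀ {x y} (x∈p : x ∈ p) (y∈p : y ∈ p) → h x∈p ≡ h y∈p → x ≡ y
  h-inj x∈p y∈p =
    suc-injective ∘ g-inj (there x∈p) (there y∈p) ∘ punchOut-injective (g₀≢ x∈p) (g₀≢ y∈p)

join-injective : ∀ m n {a b : Fin m ⊎ Fin n} → join m n a ≡ join m n b → a ≡ b
join-injective m n {a} {b} e = trans (sym (splitAt-join m n a)) (trans (cong (splitAt m) e) (splitAt-join m n b))

map₂-injective : ∀ {A B C : Set} {f : B → C} → (∀ {x y} → f x ≡ f y → x ≡ y) →
                 ∀ {a b : A ⊎ B} → map₂ f a ≡ map₂ f b → a ≡ b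
map₂-injective f-inj {inj₁ _} {inj₁ _} refl = refl
map₂-injective f-inj {inj₂ _} {inj₂ _} e    = cong inj₂ (f-inj (inj₂-injective e))

map₂-≡inj₁ : ∀ {A B C : Set} {f : B → C} {a : A ⊎ B} {x} → map₂ f a ≡ inj₁ x → a ≡ inj₁ x
map₂-≡inj₁ {a = inj₁ _} refl = refl

map₂-suc≢inj₂-zero : ∀ {A : Set} {r} (a : A ⊎ Fin r) → map₂ Fin.suc a ≢ inj₂ Fin.zero
map₂-suc≢inj₂-zero (inj₁ _) ()
map₂-suc≢inj₂-zero (inj₂ _) ()

ProperColouring : (G : Graph) {A : Set} → (Fin (n G) → A) → Set
ProperColouring G c = ∀ u v → T (adj G u v) → c u ≢ c v

FirstBlockIsClique : (G : Graph) {s r : ℕ} → (Fin (n G) → Fin s ⊎ Fin r) → Set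
FirstBlockIsClique G σ = ∀ {u v b b′} → σ u ≡ inj₁ b → σ v ≡ inj₁ b′ → u ≢ v → T (adj G u v)

module _ (G : Graph) where

  ∈closedNbhd⁻ : ∀ {u v} → u ∈ closedNbhd G v → u ≡ v ⊎ T (adj G v u)
  ∈closedNbhd⁻ u∈ = map₁ toWitness (to T-∨ (∈tabulate⁻ u∈))

  ∈closedNbhd-self : ∀ {v} → v ∈ closedNbhd G v
  ∈closedNbhd-self {v} = ∈tabulate⁺ (from (T-∨ {⌊ v ≟ v ⌋}) (inj₁ (fromWitness refl)))

  adj⇒∈closedNbhd : ∀ {u v} → T (adj G v u) → u ∈ closedNbhd G v
  adj⇒∈closedNbhd {u} {v} a = ∈tabulate⁺ (from (T-∨ {⌊ u ≟ v ⌋}) (inj₂ a))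

  ∈image⁻ : ∀ {m} (σ : Fin (n G) → Fin m) (S : Subset (n G)) {c} →
            c ∈ image G σ S → ∃ λ v → v ∈ S × σ v ≡ c
  ∈image⁻ σ S c∈ with anyFin⁻ (n G) _ (∈tabulate⁻ c∈)
  ... | v , t with to T-∧ t
  ...   | v∈S , σv≡c = v , lookup⇒[]= v S (to T-≡ v∈S) , toWitness σv≡c

  proper-∘ : ∀ {A : Set} {k} {c : Fin (n G) → A} {h : A → Fin k} →
             (∀ {a b} → h a ≡ h b → a ≡ b) → ProperColouring G c → Proper G (h ∘ c)
  proper-∘ h-inj c-proper u v _ _ a = c-proper u v a ∘ h-inj

-- A colour of σ(S) from the first block is sent to the χ-colour of a vertex of S carrying it, any
-- other colour to itself; this is injective since first-block colours are carried by a clique.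
discrepancy≤secondBlock : ∀ (G : Graph) {s r} (σ : Fin (n G) → Fin s ⊎ Fin r) →
                          FirstBlockIsClique G σ → DiscrepancyOfAtMost G (join s r ∘ σ) r
discrepancy≤secondBlock G {s} {r} σ σ-clique S k ((f , f-proper) , _) =
  injectiveOn⇒∣p∣≤ (image G (join s r ∘ σ) S) g g-injective
  where
  tag : Fin (n G) → Fin s ⊎ Fin r → Fin k ⊎ Fin r
  tag v = map₁ (λ _ → f v)

  tag-injectiveOn : ∀ {v v′} → v ∈ S → v′ ∈ S → tag v (σ v) ≡ tag v′ (σ v′) → σ v ≡ σ v′
  tag-injectiveOn {v} {v′} v∈S v′∈S e with σ v in σv | σ v′ in σv′
  ... | inj₂ _ | inj₂ _ = cong inj₂ (inj₂-injective e)
  ... | inj₁ _ | inj₁ _ with v ≟ v′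
  ...   | yes refl = trans (sym σv) σv′
  ...   | no v≢v′  = ⊥-elim (f-proper v v′ v∈S v′∈S (σ-clique σv σv′ v≢v′) (inj₁-injective e))

  g : ∀ {c} → c ∈ image G (join s r ∘ σ) S → Fin (k + r)
  g c∈ = let v = proj₁ (∈image⁻ G _ S c∈) in join k r (tag v (σ v))

  g-injective : ∀ {c c′} (c∈ : c ∈ image G (join s r ∘ σ) S) (c′∈ : c′ ∈ image G (join s r ∘ σ) S) →
                g c∈ ≡ g c′∈ → c ≡ c′
  g-injective c∈ c′∈ e =
    let _ , v∈S , σv≡c = ∈image⁻ G _ S c∈
        _ , v′∈S , σv′≡c′ = ∈image⁻ G _ S c′∈
    in trans (sym σv≡c) (trans (cong (join s r) (tag-injectiveOn v∈S v′∈S (join-injective k r e))) σv′≡c′)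

K-properOn-id : ∀ {s} (S : Subset s) → ProperOn (K s) S id
K-properOn-id S u v _ _ = toWitnessFalse

χ-K : ∀ s → IsChromaticNumber (K s) s
χ-K s = (id , K-properOn-id ⊤) , λ m (f , f-proper) → injective⇒≤ (injective f-proper)
  where
  injective : ∀ {m} {f : Fin s → Fin m} → Proper (K s) f → ∀ {u v} → f u ≡ f v → u ≡ v
  injective f-proper {u} {v} fu≡fv =
    decidable-stable (u ≟ v) (λ u≢v → f-proper u v ∈⊤ ∈⊤ (fromWitnessFalse u≢v) fu≡fv)

module Mycielski (G : Graph) where
  private
    m : ℕ
    m = n G
    M : Graph
    M = Mycielskian G

  hub : Fin (suc (m + m))
  hub = zero

  orig twin : Fin m → Fin (suc (m + m))
  orig x = suc (x ↑ˡ m)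
  twin x = suc (m ↑ʳ x)

  data View : Fin (suc (m + m)) → Set where
    isHub  : View hub
    isOrig : ∀ x → View (orig x)
    isTwin : ∀ x → View (twin x)

  view : ∀ v → View v
  view zero = isHub
  view (suc i) with splitAt m i in eq
  ... | inj₁ x = subst View (cong suc (splitAt⁻¹-↑ˡ eq)) (isOrig x)
  ... | inj₂ x = subst View (cong suc (splitAt⁻¹-↑ʳ eq)) (isTwin x)

  adjᵛ : ∀ {u v} → View u → View v → Bool
  adjᵛ isHub      (isTwin _) = true
  adjᵛ (isTwin _) isHub      = true
  adjᵛ (isOrig x) (isOrig y) = adj G x y
  adjᵛ (isOrig x) (isTwin y) = adj G x y
  adjᵛ (isTwin x) (isOrig y) = adj G x y
  adjᵛ _          _          = false

  adj≡adjᵛ : ∀ {u v} (p : View u) (q : View v) → adj M u v ≡ adjᵛ p q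
  adj≡adjᵛ isHub      isHub      = refl
  adj≡adjᵛ isHub      (isOrig y) rewrite splitAt-↑ˡ m y m = refl
  adj≡adjᵛ isHub      (isTwin y) rewrite splitAt-↑ʳ m m y = refl
  adj≡adjᵛ (isOrig x) isHub      rewrite splitAt-↑ˡ m x m = refl
  adj≡adjᵛ (isTwin x) isHub      rewrite splitAt-↑ʳ m m x = refl
  adj≡adjᵛ (isOrig x) (isOrig y) rewrite splitAt-↑ˡ m x m | splitAt-↑ˡ m y m = refl
  adj≡adjᵛ (isOrig x) (isTwin y) rewrite splitAt-↑ˡ m x m | splitAt-↑ʳ m m y = refl
  adj≡adjᵛ (isTwin x) (isOrig y) rewrite splitAt-↑ʳ m m x | splitAt-↑ˡ m y m = refl
  adj≡adjᵛ (isTwin x) (isTwin y) rewrite splitAt-↑ʳ m m x | splitAt-↑ʳ m m y = refl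

  adj⇒adjᵛ : ∀ {u v} (p : View u) (q : View v) → T (adj M u v) → T (adjᵛ p q)
  adj⇒adjᵛ p q = subst T (adj≡adjᵛ p q)

  adjᵛ⇒adj : ∀ {u v} (p : View u) (q : View v) → T (adjᵛ p q) → T (adj M u v)
  adjᵛ⇒adj p q = subst T (sym (adj≡adjᵛ p q))

  orig-injective : ∀ {x y} → orig x ≡ orig y → x ≡ y
  orig-injective {x} {y} = ↑ˡ-injective m x y ∘ suc-injective

  twin-injective : ∀ {x y} → twin x ≡ twin y → x ≡ y
  twin-injective {x} {y} = ↑ʳ-injective m x y ∘ suc-injective

  orig≢twin : ∀ {x y} → orig x ≢ twin y
  orig≢twin {x} {y} e with join-injective m m {inj₁ x} {inj₂ y} (suc-injective e)
  ... | ()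

  colourBy : ∀ {A : Set} → (∀ {u} → View u → A) → Fin (suc (m + m)) → A
  colourBy f u = f (view u)

  properOn-colourBy : ∀ {k} {S : Subset (suc (m + m))} (f : ∀ {u} → View u → Fin k) →
    (∀ {u v} (p : View u) (q : View v) → u ∈ S → v ∈ S → T (adjᵛ p q) → f p ≢ f q) →
    ProperOn M S (colourBy f)
  properOn-colourBy f f-proper u v u∈S v∈S a = f-proper (view u) (view v) u∈S v∈S (adj⇒adjᵛ (view u) (view v) a)

  lift : ∀ {A : Set} → (Fin m → A) → A → ∀ {u} → View u → A
  lift c d isHub      = d
  lift c d (isOrig x) = c x
  lift c d (isTwin x) = c x

  lift-properOn : ∀ {k} {S′ : Subset m} {S : Subset (suc (m + m))} {c : Fin m → Fin k} {d : Fin k} →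
    ProperOn G S′ c →
    (∀ {x} → orig x ∈ S → x ∈ S′) →
    (∀ {x} → twin x ∈ S → x ∈ S′) →
    (hub ∈ S → ∀ {x} → twin x ∈ S → d ≢ c x) →
    ProperOn M S (colourBy (lift c d))
  lift-properOn {S = S} {c = c} {d} c-proper orig∈ twin∈ hub-twin = properOn-colourBy (lift c d) proper
    where
    proper : ∀ {u v} (p : View u) (q : View v) → u ∈ S → v ∈ S → T (adjᵛ p q) → lift c d p ≢ lift c d q
    proper isHub      (isTwin y) h∈ t∈ _ = hub-twin h∈ t∈
    proper (isTwin x) isHub      t∈ h∈ _ = hub-twin h∈ t∈ ∘ sym
    proper (isOrig x) (isOrig y) x∈ y∈ a = c-proper x y (orig∈ x∈) (orig∈ y∈) a
    proper (isOrig x) (isTwin y) x∈ y∈ a = c-proper x y (orig∈ x∈) (twin∈ y∈) a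
    proper (isTwin x) (isOrig y) x∈ y∈ a = c-proper x y (twin∈ x∈) (orig∈ y∈) a
    proper isHub      isHub      _  _  ()
    proper isHub      (isOrig _) _  _  ()
    proper (isOrig _) isHub      _  _  ()
    proper (isTwin _) (isTwin _) _  _  ()

  colourable⁺ : ∀ {k} → ColourableOn G ⊤ k → ColourableOn M ⊤ (suc k)
  colourable⁺ {k} (c , c-proper) =
      colourBy (lift (inject₁ ∘ c) (fromℕ k))
    , lift-properOn (proper-∘ G inject₁-injective (λ u v → c-proper u v ∈⊤ ∈⊤))
                    (λ _ → ∈⊤) (λ _ → ∈⊤) (λ _ _ → fromℕ≢inject₁)

  -- An original vertex sharing the hub's colour is recoloured with its twin's colour, which
  -- differs from the hub's; dropping the hub's colour then leaves a proper k-colouring of G.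
  colourable⁻ : ∀ {k} → ColourableOn M ⊤ (suc k) → ColourableOn G ⊤ k
  colourable⁻ {k} (f , f-proper) = (λ u → punchOut (hub≢recolour u)) , proper
    where
    edge : ∀ {u v} (p : View u) (q : View v) → T (adjᵛ p q) → f u ≢ f v
    edge {u} {v} p q a = f-proper u v ∈⊤ ∈⊤ (adjᵛ⇒adj p q a)

    recolour : Fin m → Fin (suc k)
    recolour u with f (orig u) ≟ f hub
    ... | yes _ = f (twin u)
    ... | no  _ = f (orig u)

    hub≢recolour : ∀ u → f hub ≢ recolour u
    hub≢recolour u with f (orig u) ≟ f hub
    ... | yes _   = edge isHub (isTwin u) _
    ... | no  o≢h = o≢h ∘ sym

    recolour-proper : ∀ u v → T (adj G u v) → recolour u ≢ recolour v
    recolour-proper u v a with f (orig u) ≟ f hub | f (orig v) ≟ f hub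
    ... | yes u≡h | yes v≡h = λ _ → edge (isOrig u) (isOrig v) a (trans u≡h (sym v≡h))
    ... | yes _   | no  _   = edge (isTwin u) (isOrig v) a
    ... | no  _   | yes _   = edge (isOrig u) (isTwin v) a
    ... | no  _   | no  _   = edge (isOrig u) (isOrig v) a

    proper : Proper G (λ u → punchOut (hub≢recolour u))
    proper u v _ _ a = recolour-proper u v a ∘ punchOut-injective (hub≢recolour u) (hub≢recolour v)

  private
    N : Fin (suc (m + m)) → Subset (suc (m + m))
    N = closedNbhd M

  hub∉N[orig] : ∀ {x} → hub ∉ N (orig x)
  hub∉N[orig] {x} h∈ with ∈closedNbhd⁻ M {v = orig x} h∈
  ... | inj₁ ()
  ... | inj₂ a = adj⇒adjᵛ (isOrig x) isHub a

  orig∉N[hub] : ∀ {y} → orig y ∉ N hub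
  orig∉N[hub] {y} y∈ with ∈closedNbhd⁻ M {v = hub} y∈
  ... | inj₁ ()
  ... | inj₂ a = adj⇒adjᵛ isHub (isOrig y) a

  orig∈N[orig]⁻ : ∀ {x y} → orig y ∈ N (orig x) → y ∈ closedNbhd G x
  orig∈N[orig]⁻ {x} {y} y∈ with ∈closedNbhd⁻ M {v = orig x} y∈
  ... | inj₁ y≡x rewrite orig-injective y≡x = ∈closedNbhd-self G
  ... | inj₂ a = adj⇒∈closedNbhd G (adj⇒adjᵛ (isOrig x) (isOrig y) a)

  twin∈N[orig]⁻ : ∀ {x y} → twin y ∈ N (orig x) → y ∈ closedNbhd G x
  twin∈N[orig]⁻ {x} {y} y∈ with ∈closedNbhd⁻ M {v = orig x} y∈
  ... | inj₁ y≡x = ⊥-elim (orig≢twin (sym y≡x))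
  ... | inj₂ a = adj⇒∈closedNbhd G (adj⇒adjᵛ (isOrig x) (isTwin y) a)

  orig∈N[twin]⁻ : ∀ {x y} → orig y ∈ N (twin x) → y ∈ closedNbhd G x
  orig∈N[twin]⁻ {x} {y} y∈ with ∈closedNbhd⁻ M {v = twin x} y∈
  ... | inj₁ y≡x = ⊥-elim (orig≢twin y≡x)
  ... | inj₂ a = adj⇒∈closedNbhd G (adj⇒adjᵛ (isTwin x) (isOrig y) a)

  twin∈N[twin]⁻ : ∀ {x y} → twin y ∈ N (twin x) → y ≡ x
  twin∈N[twin]⁻ {x} {y} y∈ with ∈closedNbhd⁻ M {v = twin x} y∈
  ... | inj₁ y≡x = twin-injective y≡x
  ... | inj₂ a = ⊥-elim (adj⇒adjᵛ (isTwin x) (isTwin y) a)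

  -- N[hub] is a star, as twins are pairwise non-adjacent; N[orig u] and N[twin u] project onto
  -- N_G[u], and twin u is the only twin in N[twin u], so there the hub just avoids the colour of u.
  locallyColourable⁺ : ∀ {t} → 2 ≤ t → LocallyColourable G t → LocallyColourable M t
  locallyColourable⁺ {t} (s≤s (s≤s _)) lc v with view v
  ... | isHub = colourBy star , properOn-colourBy star star-proper
    where
    star : ∀ {u} → View u → Fin t
    star isHub = zero
    star _     = suc zero
    star-proper : ∀ {u v} (p : View u) (q : View v) → u ∈ N hub → v ∈ N hub → T (adjᵛ p q) →
                  star p ≢ star q
    star-proper isHub      (isTwin _) _  _  _ = λ ()
    star-proper (isTwin _) isHub      _  _  _ = λ ()
    star-proper (isOrig _) _          x∈ _  _ = ⊥-elim (orig∉N[hub] x∈)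
    star-proper _          (isOrig _) _  y∈ _ = ⊥-elim (orig∉N[hub] y∈)
    star-proper isHub      isHub      _  _  ()
    star-proper (isTwin _) (isTwin _) _  _  ()
  ... | isOrig u =
    let c , c-proper = lc u in
      colourBy (lift c (c u))
    , lift-properOn c-proper orig∈N[orig]⁻ twin∈N[orig]⁻ (⊥-elim ∘ hub∉N[orig])
  ... | isTwin u =
    let c , c-proper = lc u in
      colourBy (lift c (punchIn (c u) zero))
    , lift-properOn c-proper orig∈N[twin]⁻
        (λ y∈ → subst (_∈ closedNbhd G u) (sym (twin∈N[twin]⁻ y∈)) (∈closedNbhd-self G))
        (λ _ y∈ → subst (λ y → punchIn (c u) zero ≢ c y) (sym (twin∈N[twin]⁻ y∈))
                        (punchInᵢ≢i (c u) zero))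

  module _ {s r} (σ : Fin m → Fin s ⊎ Fin (suc r)) where

    blockColouring⁺ : ∀ {u} → View u → Fin s ⊎ Fin (suc (suc r))
    blockColouring⁺ isHub      = inj₂ (suc zero)
    blockColouring⁺ (isOrig x) = map₂ suc (σ x)
    blockColouring⁺ (isTwin _) = inj₂ zero

    blockColouring⁺-proper : ProperColouring G σ → ProperColouring M (colourBy blockColouring⁺)
    blockColouring⁺-proper σ-proper u v a = proper (view u) (view v) (adj⇒adjᵛ (view u) (view v) a)
      where
      proper : ∀ {u v} (p : View u) (q : View v) → T (adjᵛ p q) → blockColouring⁺ p ≢ blockColouring⁺ q
      proper isHub      (isTwin _) _ = λ ()
      proper (isTwin _) isHub      _ = λ ()
      proper (isOrig x) (isOrig y) a = σ-proper x y a ∘ map₂-injective suc-injective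
      proper (isOrig x) (isTwin _) _ = map₂-suc≢inj₂-zero (σ x)
      proper (isTwin _) (isOrig y) _ = map₂-suc≢inj₂-zero (σ y) ∘ sym
      proper isHub      isHub      ()
      proper isHub      (isOrig _) ()
      proper (isOrig _) isHub      ()
      proper (isTwin _) (isTwin _) ()

    blockColouring⁺-firstBlockIsClique :
      FirstBlockIsClique G σ → FirstBlockIsClique M (colourBy blockColouring⁺)
    blockColouring⁺-firstBlockIsClique σ-clique {u} {v} e e′ u≢v =
      adjᵛ⇒adj (view u) (view v) (clique (view u) (view v) e e′ u≢v)
      where
      clique : ∀ {u v b b′} (p : View u) (q : View v) →
               blockColouring⁺ p ≡ inj₁ b → blockColouring⁺ q ≡ inj₁ b′ → u ≢ v → T (adjᵛ p q)
      clique (isOrig _) (isOrig _) e e′ u≢v = σ-clique (map₂-≡inj₁ e) (map₂-≡inj₁ e′) (u≢v ∘ cong orig)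
      clique isHub      _          ()
      clique (isTwin _) _          ()
      clique (isOrig _) isHub      _ ()
      clique (isOrig _) (isTwin _) _ ()

χ-Mycielskian : ∀ {G k} → IsChromaticNumber G k → IsChromaticNumber (Mycielskian G) (suc k)
χ-Mycielskian {G} {k} (colourable , minimal) = colourable⁺ colourable , minimal′
  where
  open Mycielski G
  minimal′ : ∀ l → ColourableOn (Mycielskian G) ⊤ l → suc k ≤ l
  minimal′ zero    (f , _)      with f hub
  ... | ()
  minimal′ (suc l) colourable′ = s≤s (minimal l (colourable⁻ colourable′))

χ-MycIter : ∀ s j → IsChromaticNumber (MycIter s j) (j + s)
χ-MycIter s zero    = χ-K s
χ-MycIter s (suc j) = χ-Mycielskian (χ-MycIter s j)

locallyColourable-MycIter : ∀ {s} → 2 ≤ s → ∀ j → LocallyColourable (MycIter s j) s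
locallyColourable-MycIter _   zero    v = id , K-properOn-id _
locallyColourable-MycIter 2≤s (suc j)   = Mycielski.locallyColourable⁺ _ 2≤s (locallyColourable-MycIter 2≤s j)

blockColouring : ∀ s j → Fin (n (MycIter s j)) → Fin s ⊎ Fin (suc j)
blockColouring s zero    = inj₁
blockColouring s (suc j) = colourBy (blockColouring⁺ (blockColouring s j))
  where open Mycielski (MycIter s j)

blockColouring-proper : ∀ s j → ProperColouring (MycIter s j) (blockColouring s j)
blockColouring-proper s zero    u v a = toWitnessFalse a ∘ inj₁-injective
blockColouring-proper s (suc j) = Mycielski.blockColouring⁺-proper _ _ (blockColouring-proper s j)

blockColouring-firstBlockIsClique : ∀ s j → FirstBlockIsClique (MycIter s j) (blockColouring s j)
blockColouring-firstBlockIsClique s zero    _ _ = fromWitnessFalse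
blockColouring-firstBlockIsClique s (suc j) =
  Mycielski.blockColouring⁺-firstBlockIsClique _ _ (blockColouring-firstBlockIsClique s j)

proposition4p1 : (k s : ℕ) → 2 ≤ s → s ≤ k →
    LocallyColourable (Myc k s) s
    × IsChromaticNumber (Myc k s) k
    × ChromaticDiscrepancyAtMost (Myc k s) (k ∸ s + 1)
proposition4p1 k s 2≤s s≤k =
    locallyColourable-MycIter 2≤s j
  , subst (IsChromaticNumber (Myc k s)) (m∸n+n≡m s≤k) (χ-MycIter s j)
  , ( s + suc j , σ , proper-∘ (Myc k s) (join-injective s (suc j)) (blockColouring-proper s j)
    , subst (DiscrepancyOfAtMost (Myc k s) σ) (+-comm 1 j)
        (discrepancy≤secondBlock (Myc k s) (blockColouring s j) (blockColouring-firstBlockIsClique s j)))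
  where
  j : ℕ
  j = k ∸ s
  σ : Fin (n (Myc k s)) → Fin (s + suc j)
  σ = join s (suc j) ∘ blockColouring s j
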